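{- Let $n$ be a positive integer, $\sigma\in S_3$, and $\tau=\tau_1\tau_2\cdots\tau_{n+1}\in S_{n+1}$. If $\mathrm{SC}_\sigma(\tau)=\pi_1\pi_2\cdots\pi_{n+1}$, then $\tau_1=\pi_{n+1}$.
   Context: For a permutation $\tau=\tau_1\cdots\tau_m\in S_m$ and a pattern $\sigma\in S_3$, the consecutive-pattern-avoiding stack-sorting map $\mathrm{SC}_\sigma$ is defined as follows. Read $\tau$ from left to right, using a stack that starts empty. At each step, let $x$ be the next unread entry of the input. If the stack has fewer than two entries, or if pushing $x$ would not make the top three entries of the stack, read from top to bottom, have the same relative order as $\sigma$, then push $x$ onto the stack. Otherwise, pop the top entry of the stack and append it to the output. Once the whole input has been read, pop all remaining entries one at a time from the top and append them to the output. The output permutation is $\mathrm{SC}_\sigma(\tau)\in S_m$. -}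

module Defs where

open import Data.Nat using (ℕ; zero; suc; _<ᵇ_)
open import Data.Bool using (Bool; true; false; if_then_else_; _∧_)
open import Data.Bool.Properties using () renaming (_≟_ to _≟ᵇ_)
open import Data.List using (List; []; _∷_; _++_; map; upTo)
open import Relation.Nullary.Decidable using (⌊_⌋)

-- [1, 2, ..., m], the identity permutation of S_m in one-line notation.
oneTo : ℕ → List ℕ
oneTo m = map suc (upTo m)

_≡B_ : Bool → Bool → Bool
a ≡B b = ⌊ a ≟ᵇ b ⌋

-- (a , b , c) has the same relative order as (s₁ , s₂ , s₃)
-- (for triples of distinct numbers, comparing all three pairs suffices).
sameOrder3 : ℕ → ℕ → ℕ → ℕ → ℕ → ℕ → Bool
sameOrder3 a b c s₁ s₂ s₃ =
  ((a <ᵇ b) ≡B (s₁ <ᵇ s₂)) ∧ (((a <ᵇ c) ≡B (s₁ <ᵇ s₃)) ∧ ((b <ᵇ c) ≡B (s₂ <ᵇ s₃)))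

matches : List ℕ → ℕ → ℕ → ℕ → Bool
matches (s₁ ∷ s₂ ∷ s₃ ∷ []) a b c = sameOrder3 a b c s₁ s₂ s₃
matches _ a b c = false

-- Stack is a list with its head as the top entry.
-- Handle the next input entry x: pop while pushing x would create the
-- pattern σ in the top three entries (read top to bottom: x, b, c);
-- then push x.
record State : Set where
  constructor st
  field
    out   : List ℕ
    stack : List ℕ

feed : List ℕ → ℕ → List ℕ → List ℕ → State
feed σ x out [] = st out (x ∷ [])
feed σ x out (b ∷ []) = st out (x ∷ b ∷ [])
feed σ x out (b ∷ c ∷ rest) =
  if matches σ x b c
    then feed σ x (out ++ (b ∷ [])) (c ∷ rest)
    else st out (x ∷ b ∷ c ∷ rest)

run : List ℕ → List ℕ → List ℕ → List ℕ → State
run σ [] out stk = st out stk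
run σ (x ∷ xs) out stk with feed σ x out stk
... | st out' stk' = run σ xs out' stk'

SC : List ℕ → List ℕ → List ℕ
SC σ τ with run σ τ [] []
... | st out stk = out ++ stk

{-# OPTIONS --safe #-}
module Submission where

open import Defs
open import Data.Nat using (ℕ; suc; _≥_)
open import Data.Bool using (true; false; if_then_else_)
open import Function using (_∘_)
open import Data.List using (List; []; _∷_; _++_; _∷ʳ_; last)
open import Data.List.Properties using (++-assoc)
open import Data.Maybe using (just)
open import Data.Product using (∃; _,_)
open import Data.List.Relation.Binary.Permutation.Propositional using (_↭_)
open import Relation.Binary.PropositionalEquality using (_≡_; refl; sym; cong; module ≡-Reasoning)

-- The map pops the top entry b only when some entry c lies below b, so the
-- bottom of the stack is never popped while input remains.  The first input
-- entry is pushed onto the empty stack, stays at the bottom throughout, and is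
-- therefore the last entry of the final flush.  This holds for every pattern
-- and every input list.

last-∷ʳ : ∀ {A : Set} (xs : List A) x → last (xs ∷ʳ x) ≡ just x
last-∷ʳ []           x = refl
last-∷ʳ (_ ∷ [])     x = refl
last-∷ʳ (_ ∷ y ∷ xs) x = last-∷ʳ (y ∷ xs) x

HasBottom : ℕ → List ℕ → Set
HasBottom t stk = ∃ λ ys → stk ≡ ys ∷ʳ t

if-elim : ∀ {a p} {A : Set a} (P : A → Set p) b {x y : A} →
  P x → P y → P (if b then x else y)
if-elim P true  px _  = px
if-elim P false _  py = py

feed-keeps-bottom : ∀ σ x out ys t →
  HasBottom t (State.stack (feed σ x out (ys ∷ʳ t)))
feed-keeps-bottom σ x out []  t = x ∷ [] , refl
feed-keeps-bottom σ x out (b ∷ []) t =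
  if-elim (HasBottom t ∘ State.stack) (matches σ x b t) (x ∷ [] , refl) (x ∷ b ∷ [] , refl)
feed-keeps-bottom σ x out (b ∷ cs@(c ∷ _)) t =
  if-elim (HasBottom t ∘ State.stack) (matches σ x b c)
    (feed-keeps-bottom σ x (out ++ b ∷ []) cs t) (x ∷ b ∷ cs , refl)

run-keeps-bottom : ∀ σ xs out ys t →
  HasBottom t (State.stack (run σ xs out (ys ∷ʳ t)))
run-keeps-bottom σ []       out ys t = ys , refl
run-keeps-bottom σ (x ∷ xs) out ys t
  with feed σ x out (ys ∷ʳ t) | feed-keeps-bottom σ x out ys t
... | st out′ _ | ys′ , refl = run-keeps-bottom σ xs out′ ys′ t

last-SC : ∀ σ t τ → last (SC σ (t ∷ τ)) ≡ just t
last-SC σ t τ with run σ τ [] (t ∷ []) | run-keeps-bottom σ τ [] [] t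
... | st out _ | ys , refl = begin
  last (out ++ ys ∷ʳ t)   ≡⟨ cong last (sym (++-assoc out ys (t ∷ []))) ⟩
  last ((out ++ ys) ∷ʳ t) ≡⟨ last-∷ʳ (out ++ ys) t ⟩
  just t                  ∎
  where open ≡-Reasoning

mainTheorem2 : (n : ℕ) → n ≥ 1 → (σ : List ℕ) → σ ↭ oneTo 3 →
    (τ₁ : ℕ) (τrest : List ℕ) → (τ₁ ∷ τrest) ↭ oneTo (suc n) →
    last (SC σ (τ₁ ∷ τrest)) ≡ just τ₁
mainTheorem2 _ _ σ _ τ₁ τrest _ = last-SC σ τ₁ τrest
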